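{- Let $L$ be a latin square of even order $n$ indexed by $N_n$, and let $m$ be an odd divisor of $n$. Define $\Delta_m$ on the entries of $L$ by letting $\Delta_m(r,c,s)$ be the integer of least absolute value satisfying \[\Delta_m(r,c,s)\equiv \left\lfloor\frac{s}{m}\right\rfloor-\left\lfloor\frac{r}{m}\right\rfloor-\left\lfloor\frac{c}{m}\right\rfloor \pmod{n/m}.\] Let $k$ be an odd positive integer. If $K$ is a $k$-plex of $L$, then \[\sum_{(r,c,s)\in K}\Delta_m(r,c,s)\equiv \frac{n}{2m}\pmod{\frac nm}.\]
   Context: A latin square of order $n$ indexed by $N_n=\{0,\dots,n-1\}$ is regarded as a set of entries (row, column, symbol) in $N_n^3$, each symbol occurring once per row and once per column. A $k$-plex is a set of $kn$ entries containing exactly $k$ entries from each row and from each column, with each symbol occurring in exactly $k$ of them. -}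

module Defs where

open import Data.Nat as ℕ using (ℕ; zero; suc; _/_; NonZero)
open import Data.Nat.Divisibility as ℕD using (quotient)
open import Data.Integer as ℤ using (ℤ; +_; _-_; ∣_∣)
open import Data.Integer.Divisibility as ℤD using ()
open import Data.Fin using (Fin; toℕ; _≟_)
import Data.Fin as Fin
open import Data.Bool using (Bool; true; false; if_then_else_; _∧_)
open import Data.Product using (_×_)
open import Relation.Nullary.Decidable using (⌊_⌋)
open import Relation.Binary.PropositionalEquality using (_≡_)
open import Function.Definitions using (Injective)

sumℕ : ∀ {n} → (Fin n → ℕ) → ℕ
sumℕ {zero} f = 0
sumℕ {suc n} f = f Fin.zero ℕ.+ sumℕ (λ i → f (Fin.suc i))

sumℤ : ∀ {n} → (Fin n → ℤ) → ℤ
sumℤ {zero} f = + 0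
sumℤ {suc n} f = f Fin.zero ℤ.+ sumℤ (λ i → f (Fin.suc i))

count : ∀ {n} → (Fin n → Bool) → ℕ
count f = sumℕ (λ i → if f i then 1 else 0)

-- A latin square of order n indexed by N_n = Fin n: entry (r, c, L r c).
-- Each symbol occurs once per row and once per column
-- (on a finite set of size n, injectivity ⇔ occurring exactly once).
record LatinSquare (n : ℕ) : Set where
  field
    sym    : Fin n → Fin n → Fin n
    rowInj : ∀ r → Injective _≡_ _≡_ (sym r)
    colInj : ∀ c → Injective _≡_ _≡_ (λ r → sym r c)
open LatinSquare public

-- A k-plex of L: a set of entries of L, given by the set of cells (r,c) it
-- selects (each cell carries the entry (r, c, L r c)), containing exactly k
-- entries from each row and each column, each symbol occurring exactly k times.
record IsKPlex {n : ℕ} (L : LatinSquare n) (k : ℕ) (K : Fin n → Fin n → Bool) : Set where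
  field
    size   : sumℕ (λ r → count (K r)) ≡ k ℕ.* n
    rowCnt : ∀ r → count (K r) ≡ k
    colCnt : ∀ c → count (λ r → K r c) ≡ k
    symCnt : ∀ s → sumℕ (λ r → count (λ c → K r c ∧ ⌊ sym L r c ≟ s ⌋)) ≡ k

_≡_[mod_] : ℤ → ℤ → ℕ → Set
a ≡ b [mod q ] = (+ q) ℤD.∣ (a - b)

IsLeastAbsRep : ℕ → ℤ → ℤ → Set
IsLeastAbsRep q a z = (z ≡ a [mod q ]) × (∀ w → w ≡ a [mod q ] → ∣ z ∣ ℕ.≤ ∣ w ∣)

blockDiff : ∀ {n} (m : ℕ) .{{_ : NonZero m}} → Fin n → Fin n → Fin n → ℤ
blockDiff m r c s = (+ (toℕ s / m) - + (toℕ r / m)) - + (toℕ c / m)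

sumOver : ∀ {n} (L : LatinSquare n) (K : Fin n → Fin n → Bool)
          (Δ : Fin n → Fin n → Fin n → ℤ) → ℤ
sumOver L K Δ = sumℤ (λ r → sumℤ (λ c → if K r c then Δ r c (sym L r c) else + 0))

-- Write β i = ⌊i/m⌋, q = n/m and T = Σ_{i<n} β i. Modulo q, Δ agrees with β s − β r − β c, and a
-- k-plex meets every row, every column and every symbol exactly k times, so the sum over K is
-- ≡ kT − kT − kT = −kT. The indices split into q blocks of m on which β is constant, whence
-- 2T = m q (q − 1). Since n is even and m odd, q is even, and −kT − q/2 = −(q/2)(k m (q − 1) + 1)
-- is a multiple of q because k m (q − 1) is odd.
module Submission where

open import Defs
open import Data.Nat using (ℕ; _/_; NonZero; zero; suc)
open import Data.Nat.Divisibility using (_∣_; quotient)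
open import Data.Integer using (ℤ; +_)
open import Data.Fin using (Fin)
open import Data.Bool using (Bool)
open import Relation.Nullary using (¬_)

open import Data.Bool using (true; false; if_then_else_; _∧_)
open import Data.Fin using (zero; suc; toℕ; _≟_; _↑ˡ_; _↑ʳ_)
open import Data.Fin.Properties using (toℕ-↑ˡ; toℕ-↑ʳ; toℕ<n)
import Data.Nat as ℕ
import Data.Nat.Properties as ℕ
open import Data.Nat.DivMod using (m<n⇒m/n≡0; m*n/n≡m; n/n≡1; +-distrib-/-∣ˡ)
open import Data.Nat.Divisibility using (divides; ∣-refl; ∣m∣n⇒∣m+n; _∣0)
open import Data.Nat.Primality using (euclidsLemma; prime?)
open import Data.Integer using (_+_; _*_; -_; _-_; 0ℤ; 1ℤ; -1ℤ)
import Data.Integer.Properties as ℤ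
open import Data.Integer.Divisibility.Signed as ℤ∣
  using (∣ᵤ⇒∣; ∣⇒∣ᵤ) renaming (_∣_ to _∣ℤ_)
open import Data.Integer.Tactic.RingSolver using (solve-∀)
open import Algebra.Properties.Semiring.Sum ℤ.+-*-semiring
  using (sum; sum-syntax; sum-cong-≗; sum-replicate-zero; ∑-distrib-+; ∑-comm; *-distribˡ-sum; *-distribʳ-sum)
open import Data.Product using (∃-syntax; _,_; proj₁)
open import Data.Sum using (inj₁; inj₂)
open import Function using (_∘_)
open import Relation.Nullary using (contradiction)
open import Relation.Nullary.Decidable using (⌊_⌋; ⌊⌋-map′; from-yes)
open import Relation.Binary.PropositionalEquality
  using (_≡_; refl; cong; cong₂; subst; module ≡-Reasoning) renaming (sym to ≡-sym; trans to ≡-trans)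
open ≡-Reasoning

sumℤ≡sum : ∀ {n} (f : Fin n → ℤ) → sumℤ f ≡ sum f
sumℤ≡sum {zero}  f = refl
sumℤ≡sum {suc n} f = cong (_+_ (f zero)) (sumℤ≡sum (f ∘ suc))

+-sumℕ : ∀ {n} (f : Fin n → ℕ) → + sumℕ f ≡ ∑[ i < n ] (+ f i)
+-sumℕ {zero}  f = refl
+-sumℕ {suc n} f = cong (_+_ (+ f zero)) (+-sumℕ (f ∘ suc))

∑-neg : ∀ {n} (f : Fin n → ℤ) → ∑[ i < n ] (- f i) ≡ - sum f
∑-neg {n} f = begin
  ∑[ i < n ] (- f i)      ≡⟨ sum-cong-≗ (≡-sym ∘ ℤ.-1*i≡-i ∘ f) ⟩
  ∑[ i < n ] (-1ℤ * f i)  ≡⟨ *-distribˡ-sum -1ℤ f ⟨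
  -1ℤ * sum f             ≡⟨ ℤ.-1*i≡-i (sum f) ⟩
  - sum f                 ∎

∑-distrib-- : ∀ {n} (f g : Fin n → ℤ) → ∑[ i < n ] (f i - g i) ≡ sum f - sum g
∑-distrib-- f g = ≡-trans (∑-distrib-+ f (-_ ∘ g)) (cong (_+_ (sum f)) (∑-neg g))

∑-one : ∀ n → ∑[ i < n ] 1ℤ ≡ + n
∑-one zero    = refl
∑-one (suc n) = cong (_+_ 1ℤ) (∑-one n)

∑-split : ∀ a {b} (f : Fin (a ℕ.+ b) → ℤ) →
          sum f ≡ ∑[ i < a ] f (i ↑ˡ b) + ∑[ j < b ] f (a ↑ʳ j)
∑-split zero    f = ≡-sym (ℤ.+-identityˡ (sum f))
∑-split (suc a) f = ≡-trans (cong (_+_ (f zero)) (∑-split a (f ∘ suc)))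
                            (≡-sym (ℤ.+-assoc (f zero) _ _))

∑-if : ∀ {n} (b : Fin n → Bool) (x : ℤ) →
       ∑[ i < n ] (if b i then x else 0ℤ) ≡ x * + count b
∑-if {n} b x = begin
  ∑[ i < n ] (if b i then x else 0ℤ)          ≡⟨ sum-cong-≗ (λ i → if-else-0 (b i)) ⟩
  ∑[ i < n ] (x * + (if b i then 1 else 0))   ≡⟨ *-distribˡ-sum x (λ i → + (if b i then 1 else 0)) ⟨
  x * ∑[ i < n ] (+ (if b i then 1 else 0))   ≡⟨ cong (x *_) (+-sumℕ (λ i → if b i then 1 else 0)) ⟨
  x * + count b                               ∎
  where
  if-else-0 : ∀ c → (if c then x else 0ℤ) ≡ x * + (if c then 1 else 0)
  if-else-0 true  = ≡-sym (ℤ.*-identityʳ x)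
  if-else-0 false = ≡-sym (ℤ.*-zeroʳ x)

∑-select : ∀ {n} (g : Fin n → ℤ) (x : Fin n) →
           g x ≡ ∑[ s < n ] (if ⌊ x ≟ s ⌋ then g s else 0ℤ)
∑-select {suc n} g zero = begin
  g zero          ≡⟨ ℤ.+-identityʳ (g zero) ⟨
  g zero + 0ℤ     ≡⟨ cong (_+_ (g zero)) (sum-replicate-zero n) ⟨
  _               ∎
∑-select {suc n} g (suc x) = begin
  g (suc x)
    ≡⟨ ∑-select (g ∘ suc) x ⟩
  ∑[ s < n ] (if ⌊ x ≟ s ⌋ then g (suc s) else 0ℤ)
    ≡⟨ sum-cong-≗ (λ s → cong (λ c → if c then g (suc s) else 0ℤ) (⌊⌋-map′ _ _ (x ≟ s))) ⟨
  ∑[ s < n ] (if ⌊ suc x ≟ suc s ⌋ then g (suc s) else 0ℤ)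
    ≡⟨ ℤ.+-identityˡ _ ⟨
  _ ∎

∣-∑ : ∀ {n} {d : ℤ} (f : Fin n → ℤ) → (∀ i → d ∣ℤ f i) → d ∣ℤ sum f
∣-∑ {zero}  {d} f d∣f = ℤ∣.divides 0ℤ (≡-sym (ℤ.*-zeroˡ d))
∣-∑ {suc n}     f d∣f = ℤ∣.∣m∣n⇒∣m+n (d∣f zero) (∣-∑ (f ∘ suc) (d∣f ∘ suc))

blockIndex : ∀ {n} (m : ℕ) .{{_ : NonZero m}} → Fin n → ℤ
blockIndex m i = + (toℕ i / m)

∑-blockIndex : ∀ m .{{_ : NonZero m}} q → + 2 * sum (blockIndex {q ℕ.* m} m) ≡ + m * + q * (+ q - 1ℤ)
∑-blockIndex m zero = ≡-trans (ℤ.*-zeroʳ (+ 2)) (≡-sym (≡-trans (cong (_* -1ℤ) (ℤ.*-zeroʳ (+ m))) (ℤ.*-zeroˡ -1ℤ)))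
∑-blockIndex m (suc q) = begin
  + 2 * sum (blockIndex {suc q ℕ.* m} m)
    ≡⟨ cong (+ 2 *_) (∑-split m (blockIndex m)) ⟩
  + 2 * (∑[ i < m ] blockIndex m (i ↑ˡ q ℕ.* m) + ∑[ j < q ℕ.* m ] blockIndex m (m ↑ʳ j))
    ≡⟨ cong (+ 2 *_) (≡-trans (cong₂ _+_ first-block later-blocks) (ℤ.+-identityˡ (+ (q ℕ.* m) + sum (blockIndex {q ℕ.* m} m)))) ⟩
  + 2 * (+ (q ℕ.* m) + sum (blockIndex {q ℕ.* m} m))
    ≡⟨ ℤ.*-distribˡ-+ (+ 2) (+ (q ℕ.* m)) _ ⟩
  + 2 * + (q ℕ.* m) + + 2 * sum (blockIndex {q ℕ.* m} m)
    ≡⟨ cong₂ _+_ (cong (+ 2 *_) (ℤ.pos-* q m)) (∑-blockIndex m q) ⟩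
  + 2 * (+ q * + m) + + m * + q * (+ q - 1ℤ)
    ≡⟨ step (+ m) (+ q) ⟩
  + m * + suc q * (+ suc q - 1ℤ)
    ∎
  where
  first-block : ∑[ i < m ] blockIndex m (i ↑ˡ q ℕ.* m) ≡ 0ℤ
  first-block = ≡-trans
    (sum-cong-≗ (λ i → cong +_ (≡-trans (cong (_/ m) (toℕ-↑ˡ i (q ℕ.* m))) (m<n⇒m/n≡0 (toℕ<n i)))))
    (sum-replicate-zero m)
  shift : (j : Fin (q ℕ.* m)) → blockIndex m (m ↑ʳ j) ≡ 1ℤ + blockIndex m j
  shift j = cong +_ (begin
    toℕ (m ↑ʳ j) / m          ≡⟨ cong (_/ m) (toℕ-↑ʳ m j) ⟩
    (m ℕ.+ toℕ j) / m         ≡⟨ +-distrib-/-∣ˡ (toℕ j) (∣-refl {m}) ⟩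
    m / m ℕ.+ toℕ j / m       ≡⟨ cong (ℕ._+ toℕ j / m) (n/n≡1 m) ⟩
    1 ℕ.+ toℕ j / m           ∎)
  later-blocks : ∑[ j < q ℕ.* m ] blockIndex m (m ↑ʳ j) ≡ + (q ℕ.* m) + sum (blockIndex {q ℕ.* m} m)
  later-blocks = ≡-trans (sum-cong-≗ shift)
    (≡-trans (∑-distrib-+ (λ _ → 1ℤ) (blockIndex {q ℕ.* m} m)) (cong (_+ sum (blockIndex {q ℕ.* m} m)) (∑-one (q ℕ.* m))))
  step : ∀ M Q → + 2 * (Q * M) + M * Q * (Q - 1ℤ) ≡ M * (1ℤ + Q) * ((1ℤ + Q) - 1ℤ)
  step = solve-∀

≡-mod-trans : ∀ {a b c q} → a ≡ b [mod q ] → b ≡ c [mod q ] → a ≡ c [mod q ]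
≡-mod-trans {a} {b} {c} {q} a≡b b≡c =
  ∣⇒∣ᵤ (subst (+ q ∣ℤ_) (telescope a b c) (ℤ∣.∣m∣n⇒∣m+n (∣ᵤ⇒∣ {i = a - b} a≡b) (∣ᵤ⇒∣ {i = b - c} b≡c)))
  where
  telescope : ∀ x y z → (x - y) + (y - z) ≡ x - z
  telescope = solve-∀

¬2∣⇒≡1+2* : ∀ {x} → ¬ 2 ∣ x → ∃[ b ] x ≡ 1 ℕ.+ 2 ℕ.* b
¬2∣⇒≡1+2* {zero}        ¬2∣x = contradiction (2 ∣0) ¬2∣x
¬2∣⇒≡1+2* {suc zero}    _    = 0 , refl
¬2∣⇒≡1+2* {suc (suc x)} ¬2∣x with ¬2∣⇒≡1+2* (¬2∣x ∘ ∣m∣n⇒∣m+n (∣-refl {2}))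
... | b , refl = suc b , cong suc (≡-sym (ℕ.*-suc 2 b))

2∣*-¬2∣⇒2∣ : ∀ q {m} → 2 ∣ q ℕ.* m → ¬ 2 ∣ m → 2 ∣ q
2∣*-¬2∣⇒2∣ q {m} 2∣qm ¬2∣m with euclidsLemma q m (from-yes (prime? 2)) 2∣qm
... | inj₁ 2∣q = 2∣q
... | inj₂ 2∣m = contradiction 2∣m ¬2∣m

-[T*k]≡q/2-mod-q : ∀ {q m k} (T : ℤ) → 2 ∣ q → ¬ 2 ∣ m → ¬ 2 ∣ k →
                         + 2 * T ≡ + m * + q * (+ q - 1ℤ) → (- (T * + k)) ≡ + (q / 2) [mod q ]
-[T*k]≡q/2-mod-q T (divides h refl) ¬2∣m ¬2∣k 2T≡ with ¬2∣⇒≡1+2* ¬2∣m | ¬2∣⇒≡1+2* ¬2∣k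
... | b , refl | a , refl = ∣⇒∣ᵤ (ℤ∣.divides (- (H + C * (H * + 2 - 1ℤ))) (begin
  - (T * + (1 ℕ.+ 2 ℕ.* a)) - + (h ℕ.* 2 / 2)
    ≡⟨ cong₂ (λ t x → - (t * (1ℤ + x)) - + (h ℕ.* 2 / 2)) T≡ (ℤ.pos-* 2 a) ⟩
  - (M * H * (H * + 2 - 1ℤ) * (1ℤ + + 2 * A)) - + (h ℕ.* 2 / 2)
    ≡⟨ cong (λ x → - (M * H * (H * + 2 - 1ℤ) * (1ℤ + + 2 * A)) - + x) (m*n/n≡m h 2) ⟩
  - (M * H * (H * + 2 - 1ℤ) * (1ℤ + + 2 * A)) - H
    ≡⟨ factor H A B ⟩
  - (H + C * (H * + 2 - 1ℤ)) * (H * + 2)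
    ≡⟨ cong (- (H + C * (H * + 2 - 1ℤ)) *_) (ℤ.pos-* h 2) ⟨
  - (H + C * (H * + 2 - 1ℤ)) * + (h ℕ.* 2)
    ∎))
  where
  H : ℤ
  H = + h
  A : ℤ
  A = + a
  B : ℤ
  B = + b
  M : ℤ
  M = 1ℤ + + 2 * B
  C : ℤ
  C = A + B + + 2 * A * B
  T≡ : T ≡ M * H * (H * + 2 - 1ℤ)
  T≡ = ℤ.*-cancelˡ-≡ (+ 2) T (M * H * (H * + 2 - 1ℤ)) (begin
    + 2 * T                                              ≡⟨ 2T≡ ⟩
    + (1 ℕ.+ 2 ℕ.* b) * + (h ℕ.* 2) * (+ (h ℕ.* 2) - 1ℤ)
      ≡⟨ cong₂ (λ x y → (1ℤ + x) * y * (y - 1ℤ)) (ℤ.pos-* 2 b) (ℤ.pos-* h 2) ⟩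
    M * (H * + 2) * (H * + 2 - 1ℤ)                       ≡⟨ double M H ⟩
    + 2 * (M * H * (H * + 2 - 1ℤ))                       ∎)
    where
    double : ∀ X Y → X * (Y * + 2) * (Y * + 2 - 1ℤ) ≡ + 2 * (X * Y * (Y * + 2 - 1ℤ))
    double = solve-∀
  factor : ∀ X Y Z → - ((1ℤ + + 2 * Z) * X * (X * + 2 - 1ℤ) * (1ℤ + + 2 * Y)) - X
                     ≡ - (X + (Y + Z + + 2 * Y * Z) * (X * + 2 - 1ℤ)) * (X * + 2)
  factor = solve-∀

module _ {n} (L : LatinSquare n) (K : Fin n → Fin n → Bool) where

  restrict : (Fin n → Fin n → Fin n → ℤ) → Fin n → Fin n → ℤ
  restrict Δ r c = if K r c then Δ r c (sym L r c) else 0ℤ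

  sumOver≡∑∑ : (Δ : Fin n → Fin n → Fin n → ℤ) → sumOver L K Δ ≡ ∑[ r < n ] ∑[ c < n ] restrict Δ r c
  sumOver≡∑∑ Δ = ≡-trans (sumℤ≡sum (λ r → sumℤ (restrict Δ r))) (sum-cong-≗ (λ r → sumℤ≡sum (restrict Δ r)))

  sumOver-- : (Δ Δ′ : Fin n → Fin n → Fin n → ℤ) →
              sumOver L K (λ r c s → Δ r c s - Δ′ r c s) ≡ sumOver L K Δ - sumOver L K Δ′
  sumOver-- Δ Δ′ = begin
    sumOver L K (λ r c s → Δ r c s - Δ′ r c s)
      ≡⟨ sumOver≡∑∑ (λ r c s → Δ r c s - Δ′ r c s) ⟩
    ∑[ r < n ] ∑[ c < n ] restrict (λ r c s → Δ r c s - Δ′ r c s) r c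
      ≡⟨ sum-cong-≗ (λ r → ≡-trans (sum-cong-≗ (λ c → if-distrib-- (K r c))) (∑-distrib-- (restrict Δ r) (restrict Δ′ r))) ⟩
    ∑[ r < n ] (∑[ c < n ] restrict Δ r c - ∑[ c < n ] restrict Δ′ r c)
      ≡⟨ ∑-distrib-- (λ r → ∑[ c < n ] restrict Δ r c) (λ r → ∑[ c < n ] restrict Δ′ r c) ⟩
    ∑[ r < n ] ∑[ c < n ] restrict Δ r c - ∑[ r < n ] ∑[ c < n ] restrict Δ′ r c
      ≡⟨ cong₂ _-_ (sumOver≡∑∑ Δ) (sumOver≡∑∑ Δ′) ⟨
    sumOver L K Δ - sumOver L K Δ′
      ∎
    where
    if-distrib-- : ∀ {x y} b → (if b then x - y else 0ℤ) ≡ (if b then x else 0ℤ) - (if b then y else 0ℤ)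
    if-distrib-- true  = refl
    if-distrib-- false = refl

  ∣-sumOver : ∀ {d} (Δ : Fin n → Fin n → Fin n → ℤ) → (∀ r c s → d ∣ℤ Δ r c s) → d ∣ℤ sumOver L K Δ
  ∣-sumOver {d} Δ d∣Δ = subst (d ∣ℤ_) (≡-sym (sumOver≡∑∑ Δ))
    (∣-∑ _ (λ r → ∣-∑ (restrict Δ r) (λ c → ∣-if (K r c) (d∣Δ r c (sym L r c)))))
    where
    ∣-if : ∀ {x} b → d ∣ℤ x → d ∣ℤ (if b then x else 0ℤ)
    ∣-if true  d∣x = d∣x
    ∣-if false _   = ℤ∣.divides 0ℤ (≡-sym (ℤ.*-zeroˡ d))

  sumOver-mod : ∀ {q} (Δ Δ′ : Fin n → Fin n → Fin n → ℤ) → (∀ r c s → Δ r c s ≡ Δ′ r c s [mod q ]) →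
                sumOver L K Δ ≡ sumOver L K Δ′ [mod q ]
  sumOver-mod {q} Δ Δ′ Δ≡Δ′ = ∣⇒∣ᵤ (subst (+ q ∣ℤ_) (sumOver-- Δ Δ′)
    (∣-sumOver (λ r c s → Δ r c s - Δ′ r c s) (λ r c s → ∣ᵤ⇒∣ (Δ≡Δ′ r c s))))

  module _ {k} (kplex : IsKPlex L k K) where
    open IsKPlex kplex

    sumOver-row : (g : Fin n → ℤ) → sumOver L K (λ r _ _ → g r) ≡ sum g * + k
    sumOver-row g = begin
      sumOver L K (λ r _ _ → g r)                          ≡⟨ sumOver≡∑∑ (λ r _ _ → g r) ⟩
      ∑[ r < n ] ∑[ c < n ] (if K r c then g r else 0ℤ)   ≡⟨ sum-cong-≗ (λ r → ∑-if (K r) (g r)) ⟩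
      ∑[ r < n ] (g r * + count (K r))                     ≡⟨ sum-cong-≗ (λ r → cong (λ t → g r * + t) (rowCnt r)) ⟩
      ∑[ r < n ] (g r * + k)                               ≡⟨ *-distribʳ-sum (+ k) g ⟨
      sum g * + k                                          ∎

    sumOver-col : (g : Fin n → ℤ) → sumOver L K (λ _ c _ → g c) ≡ sum g * + k
    sumOver-col g = begin
      sumOver L K (λ _ c _ → g c)                          ≡⟨ sumOver≡∑∑ (λ _ c _ → g c) ⟩
      ∑[ r < n ] ∑[ c < n ] (if K r c then g c else 0ℤ)   ≡⟨ ∑-comm (λ r c → if K r c then g c else 0ℤ) ⟩
      ∑[ c < n ] ∑[ r < n ] (if K r c then g c else 0ℤ)   ≡⟨ sum-cong-≗ (λ c → ∑-if (λ r → K r c) (g c)) ⟩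
      ∑[ c < n ] (g c * + count (λ r → K r c))             ≡⟨ sum-cong-≗ (λ c → cong (λ t → g c * + t) (colCnt c)) ⟩
      ∑[ c < n ] (g c * + k)                               ≡⟨ *-distribʳ-sum (+ k) g ⟨
      sum g * + k                                          ∎

    sumOver-symbol : (g : Fin n → ℤ) → sumOver L K (λ _ _ s → g s) ≡ sum g * + k
    sumOver-symbol g = begin
      sumOver L K (λ _ _ s → g s)
        ≡⟨ sumOver≡∑∑ (λ _ _ s → g s) ⟩
      ∑[ r < n ] ∑[ c < n ] (if K r c then g (sym L r c) else 0ℤ)
        ≡⟨ sum-cong-≗ (λ r → sum-cong-≗ (λ c → select (K r c) (sym L r c))) ⟩
      ∑[ r < n ] ∑[ c < n ] ∑[ s < n ] term r c s
        ≡⟨ sum-cong-≗ (λ r → ∑-comm (term r)) ⟩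
      ∑[ r < n ] ∑[ s < n ] ∑[ c < n ] term r c s
        ≡⟨ ∑-comm (λ r s → ∑[ c < n ] term r c s) ⟩
      ∑[ s < n ] ∑[ r < n ] ∑[ c < n ] term r c s
        ≡⟨ sum-cong-≗ (λ s → sum-cong-≗ (λ r → ∑-if (λ c → occurs r c s) (g s))) ⟩
      ∑[ s < n ] ∑[ r < n ] (g s * + count (λ c → occurs r c s))
        ≡⟨ sum-cong-≗ (λ s → *-distribˡ-sum (g s) (λ r → + count (λ c → occurs r c s))) ⟨
      ∑[ s < n ] (g s * ∑[ r < n ] (+ count (λ c → occurs r c s)))
        ≡⟨ sum-cong-≗ (λ s → cong (g s *_) (≡-trans (≡-sym (+-sumℕ (λ r → count (λ c → occurs r c s)))) (cong +_ (symCnt s)))) ⟩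
      ∑[ s < n ] (g s * + k)
        ≡⟨ *-distribʳ-sum (+ k) g ⟨
      sum g * + k
        ∎
      where
      occurs : Fin n → Fin n → Fin n → Bool
      occurs r c s = K r c ∧ ⌊ sym L r c ≟ s ⌋
      term : Fin n → Fin n → Fin n → ℤ
      term r c s = if occurs r c s then g s else 0ℤ
      select : ∀ b x → (if b then g x else 0ℤ) ≡ ∑[ s < n ] (if b ∧ ⌊ x ≟ s ⌋ then g s else 0ℤ)
      select true  x = ∑-select g x
      select false x = ≡-sym (sum-replicate-zero n)

    sumOver-blockDiff : ∀ m .{{_ : NonZero m}} → sumOver L K (blockDiff m) ≡ - (sum (blockIndex {n} m) * + k)
    sumOver-blockDiff m = begin
      sumOver L K (blockDiff m)
        ≡⟨ sumOver-- (λ r _ s → β s - β r) (λ _ c _ → β c) ⟩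
      sumOver L K (λ r _ s → β s - β r) - sumOver L K (λ _ c _ → β c)
        ≡⟨ cong₂ _-_ (sumOver-- (λ _ _ s → β s) (λ r _ _ → β r)) (sumOver-col β) ⟩
      (sumOver L K (λ _ _ s → β s) - sumOver L K (λ r _ _ → β r)) - T*k
        ≡⟨ cong (_- T*k) (cong₂ _-_ (sumOver-symbol β) (sumOver-row β)) ⟩
      (T*k - T*k) - T*k
        ≡⟨ [x-x]-x≡-x T*k ⟩
      - T*k
        ∎
      where
      β : Fin n → ℤ
      β = blockIndex m
      T*k : ℤ
      T*k = sum β * + k
      [x-x]-x≡-x : ∀ x → (x - x) - x ≡ - x
      [x-x]-x≡-x = solve-∀

lemma1p2 : (n m k : ℕ) .{{_ : NonZero m}} → 2 ∣ n → ¬ (2 ∣ m) → (d : m ∣ n)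
    → ¬ (2 ∣ k) → (L : LatinSquare n)
    → (Δ : Fin n → Fin n → Fin n → ℤ)
    → (∀ r c s → IsLeastAbsRep (quotient d) (blockDiff m r c s) (Δ r c s))
    → (K : Fin n → Fin n → Bool) → IsKPlex L k K
    → sumOver L K Δ ≡ + (quotient d / 2) [mod quotient d ]
lemma1p2 _ m k 2∣n ¬2∣m (divides q refl) ¬2∣k L Δ Δ-rep K kplex =
  ≡-mod-trans {a = sumOver L K Δ} {b = sumOver L K (blockDiff m)}
    (sumOver-mod L K Δ (blockDiff m) (λ r c s → proj₁ (Δ-rep r c s)))
    (subst (λ x → x ≡ + (q / 2) [mod q ]) (≡-sym (sumOver-blockDiff L K kplex m))
      (-[T*k]≡q/2-mod-q T (2∣*-¬2∣⇒2∣ q 2∣n ¬2∣m) ¬2∣m ¬2∣k (∑-blockIndex m q)))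
  where
  T : ℤ
  T = sum (blockIndex {q ℕ.* m} m)
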